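{- Let $w\ge2$ be an integer. In each residue class of $\mathbb{Z}[\tau]$ modulo $\tau^w$ whose elements are not divisible by $\tau$ there is a unique element of minimal absolute value. Consequently the minimal norm digit set modulo $\tau^w$ is uniquely determined.
   Context: Let $q\ge2$ be an integer, $p\in\{ -1,1\}$ and $\tau=\frac p2+i\sqrt{q-\frac14}$; $\mathbb{Z}[\tau]=\{a+b\tau:a,b\in\mathbb{Z}\}$. Let $V=\{z\in\mathbb{C}:|z|\le|z-y|\text{ for all }y\in\mathbb{Z}[\tau]\}$. A minimal norm digit set modulo $\tau^w$ is a set $\mathcal{D}\subseteq\mathbb{Z}[\tau]$ consisting of $0$ and exactly one representative of each residue class of $\mathbb{Z}[\tau]$ modulo $\tau^w$ not divisible by $\tau$, such that every such representative lies in $\tau^wV$. -}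

module Defs where

open import Data.Nat using (ℕ; zero; suc)
open import Data.Integer using (ℤ; +_; _+_; _-_; _*_; -_; _≤_)
open import Data.Product using (Σ; _×_; _,_; ∃)
open import Data.Sum using (_⊎_)
open import Relation.Binary.PropositionalEquality using (_≡_)
open import Relation.Nullary using (¬_)

-- Elements a + bτ of ℤ[τ] are encoded as pairs (a , b).
-- τ = p/2 + i√(q − 1/4) satisfies τ² = pτ − q and |a + bτ|² = a² + pab + qb².
Zτ : Set
Zτ = ℤ × ℤ

zero-τ : Zτ
zero-τ = (+ 0 , + 0)

τ-elt : Zτ
τ-elt = (+ 0 , + 1)

one-τ : Zτ
one-τ = (+ 1 , + 0)

_⊕_ : Zτ → Zτ → Zτ
(a , b) ⊕ (c , d) = (a + c , b + d)

_⊖_ : Zτ → Zτ → Zτ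
(a , b) ⊖ (c , d) = (a - c , b - d)

mulτ : ℤ → ℕ → Zτ → Zτ → Zτ
mulτ p q (a , b) (c , d) = (a * c - (+ q) * (b * d) , a * d + b * c + p * (b * d))

powτ : ℤ → ℕ → ℕ → Zτ
powτ p q zero = one-τ
powτ p q (suc w) = mulτ p q τ-elt (powτ p q w)

normτ : ℤ → ℕ → Zτ → ℤ
normτ p q (a , b) = a * a + p * (a * b) + (+ q) * (b * b)

Dividesτ : ℤ → ℕ → Zτ → Zτ → Set
Dividesτ p q x y = Σ Zτ (λ z → mulτ p q x z ≡ y)

Congτ : ℤ → ℕ → ℕ → Zτ → Zτ → Set
Congτ p q w x y = Dividesτ p q (powτ p q w) (x ⊖ y)

-- z ∈ τ^w V  (z ∈ ℤ[τ]):  z = τ^w v with |v| ≤ |v − y| for all y ∈ ℤ[τ],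
-- i.e. |z| ≤ |z − τ^w y| for all y ∈ ℤ[τ]; compared via squared absolute values.
InScaledVoronoi : ℤ → ℕ → ℕ → Zτ → Set
InScaledVoronoi p q w z =
  (y : Zτ) → normτ p q z ≤ normτ p q (z ⊖ mulτ p q (powτ p q w) y)

IsMinNormDigitSet : ℤ → ℕ → ℕ → (Zτ → Set) → Set
IsMinNormDigitSet p q w D =
  D zero-τ
  × ((d : Zτ) → D d → d ≡ zero-τ ⊎ (¬ Dividesτ p q τ-elt d))
  × ((x : Zτ) → ¬ Dividesτ p q τ-elt x →
       Σ Zτ (λ d → D d × Congτ p q w d x
         × ((d' : Zτ) → D d' → Congτ p q w d' x → d' ≡ d)))
  × ((d : Zτ) → D d → ¬ Dividesτ p q τ-elt d → InScaledVoronoi p q w d)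

module Submission where

-- Let T = τ ^ w. For y in a class, |y - T u|² = |y|² + E(u) with the excess
-- E(u) = |T|² |u|² - ⟨ℓ , u⟩ (norm-⊖-mul). The plane is covered by the six cones
-- spanned by consecutive neighbours among ±1, ±τ, ±(τ - p), and on each cone
-- E(α e + β f) = α E(e) + β E(f) + |T|² (α (α - 1) |e|² + β (β - 1) |f|² + α β ⟨e , f⟩),
-- all of whose terms are nonnegative once E is nonnegative at the neighbours. So a
-- representative that no neighbour step improves is closest in its class (descent),
-- and a second closest one differs from it by T e for a neighbour e. Then q ∣ |T|²
-- forces q to divide ⟨y , τ ^ j⟩ for some j ≥ 1, which means τ ∣ y.

open import Defs
open import Data.Nat using (ℕ)
open import Data.Integer using (ℤ; +_; -[1+_]; _≤_)
open import Data.Product using (Σ; _×_)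
open import Data.Sum using (_⊎_)
open import Relation.Binary.PropositionalEquality using (_≡_)
open import Relation.Nullary using (¬_)

import Data.Nat as ℕ
import Data.Nat.Properties as ℕₚ
import Data.Nat.Induction as ℕᵢ
open import Data.Nat using (suc; zero; z≤n; s≤s)
open import Data.Integer using (0ℤ; _+_; _-_; _*_; -_; _<_; _<?_; ∣_∣; +≤+; +<+)
open import Data.Integer.Properties
  using ( ≤-total; ≤-antisym; <-irrefl; <⇒≤; ≮⇒≥; neg-mono-≤; +-monoʳ-<; +-mono-≤; +-mono-<-≤
        ; +-identityˡ; +-identityʳ; +-inverseʳ; +-injective; *-identityˡ; *-identityʳ; -1*i≡-i
        ; neg-involutive; pos-*; i-j≡0⇒i≡j; i≤j⇒0≤j-i; 0≤i-j⇒j≤i; i*j≡0⇒i≡0∨j≡0; *-cancelˡ-≡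
        ; *-cancelˡ-≤-pos )
open import Data.Integer.Divisibility.Signed using (_∣_; divides; ∣-refl; ∣m⇒∣-m; ∣m⇒∣m*n; ∣m+n∣n⇒∣m)
open import Data.Integer.Solver using (module +-*-Solver)
open import Data.Integer.Tactic.RingSolver using (solve-∀)
open import Data.List using (List; []; _∷_)
open import Data.List.Membership.Propositional using (_∈_)
open import Data.List.Relation.Unary.Any using (here; there; any?; satisfied)
open import Data.List.Relation.Unary.All using (All; lookup)
import Data.List.Relation.Unary.All as All
open import Data.List.Relation.Unary.All.Properties using (¬Any⇒All¬)
open import Data.Product using (_,_; proj₁; proj₂)
import Data.Sum as Sum
open import Data.Sum using (inj₁; inj₂; [_,_]′)
open import Data.Empty using (⊥-elim)
open import Function using (_∘_; id)
open import Induction.WellFounded using (Acc; acc)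
import Relation.Binary.Construct.On as On
open import Relation.Binary.PropositionalEquality using (refl; sym; trans; cong; cong₂; subst; module ≡-Reasoning)
open import Relation.Nullary using (yes; no; contradiction)

open +-*-Solver using (Polynomial; con; _:+_; _:-_; :-_; _:*_; _:=_; solve)

infix 25 _•_

_•_ : ℤ → Zτ → Zτ
k • (a , b) = (k * a , k * b)

-- The polar form of the norm, polarτ p q x x ≡ + 2 * normτ p q x.
polarτ : ℤ → ℕ → Zτ → Zτ → ℤ
polarτ p q (a , b) (c , d) = + 2 * a * c + p * (a * d + b * c) + + 2 * + q * (b * d)

excess : ℤ → ℕ → ℤ → Zτ → Zτ → ℤ
excess p q K (ℓ₁ , ℓ₂) (m , n) = K * normτ p q (m , n) - (m * ℓ₁ + n * ℓ₂)

crossTerms : ℤ → ℕ → Zτ → Zτ → Zτ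
crossTerms p q z T = (polarτ p q z T , polarτ p q z (mulτ p q τ-elt T))

-- normτ p q (y ⊖ τ ^ w u) - normτ p q y, by norm-⊖-mul.
gain : ℤ → ℕ → ℕ → Zτ → Zτ → ℤ
gain p q w y = excess p q (normτ p q (powτ p q w)) (crossTerms p q y (powτ p q w))

-- ±1, ±τ, ±(τ - p): the lattice points across the six edges of the Voronoi cell V.
neighbours : ℤ → List Zτ
neighbours p = (+ 1 , + 0) ∷ (-[1+ 0 ] , + 0) ∷ (+ 0 , + 1) ∷ (+ 0 , -[1+ 0 ]) ∷ (- p , + 1) ∷ (p , -[1+ 0 ]) ∷ []

-- Coordinates with respect to 1 , - τ, where - τ is a root of X ² + p X + q.
reflect : Zτ → Zτ
reflect (a , b) = (a , - b)

IsUnit : ℤ → Set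
IsUnit σ = σ ≡ + 1 ⊎ σ ≡ -[1+ 0 ]

-- Copies of the clauses of mulτ, normτ, _⊖_, … on solver polynomials. Their
-- semantics unfolds to the ℤ[τ] operations, so `solve n (λ … → lhs := rhs) refl`
-- proves identities between the expressions they shadow.
module Shadow where

  Zτᴾ : ℕ → Set
  Zτᴾ k = Polynomial k × Polynomial k

  module _ {k : ℕ} where

    infix 25 _•ᴾ_

    _⊕ᴾ_ _⊖ᴾ_ : Zτᴾ k → Zτᴾ k → Zτᴾ k
    (a , b) ⊕ᴾ (c , d) = (a :+ c , b :+ d)
    (a , b) ⊖ᴾ (c , d) = (a :- c , b :- d)

    _•ᴾ_ : Polynomial k → Zτᴾ k → Zτᴾ k
    c •ᴾ (a , b) = (c :* a , c :* b)

    reflectᴾ : Zτᴾ k → Zτᴾ k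
    reflectᴾ (a , b) = (a , :- b)

    τᴾ oneᴾ zeroᴾ : Zτᴾ k
    τᴾ = (con (+ 0) , con (+ 1))
    oneᴾ = (con (+ 1) , con (+ 0))
    zeroᴾ = (con (+ 0) , con (+ 0))

    module _ (p Q : Polynomial k) where

      mulᴾ : Zτᴾ k → Zτᴾ k → Zτᴾ k
      mulᴾ (a , b) (c , d) = (a :* c :- Q :* (b :* d) , a :* d :+ b :* c :+ p :* (b :* d))

      normᴾ : Zτᴾ k → Polynomial k
      normᴾ (a , b) = a :* a :+ p :* (a :* b) :+ Q :* (b :* b)

      polarᴾ : Zτᴾ k → Zτᴾ k → Polynomial k
      polarᴾ (a , b) (c , d) =
        con (+ 2) :* a :* c :+ p :* (a :* d :+ b :* c) :+ con (+ 2) :* Q :* (b :* d)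

      excessᴾ : Polynomial k → Zτᴾ k → Zτᴾ k → Polynomial k
      excessᴾ K (ℓ₁ , ℓ₂) (m , n) = K :* normᴾ (m , n) :- (m :* ℓ₁ :+ n :* ℓ₂)

      crossᴾ : Zτᴾ k → Zτᴾ k → Zτᴾ k
      crossᴾ z T = (polarᴾ z T , polarᴾ z (mulᴾ τᴾ T))

open Shadow

module _ (p : ℤ) (q : ℕ) where

  norm-⊖-mul : ∀ z T u → normτ p q (z ⊖ mulτ p q T u) ≡
                         normτ p q z + excess p q (normτ p q T) (crossTerms p q z T) u
  norm-⊖-mul (z₁ , z₂) (t₁ , t₂) (u₁ , u₂) =
    solve 8 (λ p Q z₁ z₂ t₁ t₂ u₁ u₂ → let z = (z₁ , z₂) ; T = (t₁ , t₂) ; u = (u₁ , u₂) in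
      normᴾ p Q (z ⊖ᴾ mulᴾ p Q T u) :=
      normᴾ p Q z :+ excessᴾ p Q (normᴾ p Q T) (crossᴾ p Q z T) u)
      refl p (+ q) z₁ z₂ t₁ t₂ u₁ u₂

  excess-cone : ∀ K ℓ α β e f →
    excess p q K ℓ (α • e ⊕ β • f) ≡
    α * excess p q K ℓ e + β * excess p q K ℓ f
      + K * (α * (α - + 1) * normτ p q e + β * (β - + 1) * normτ p q f + α * β * polarτ p q e f)
  excess-cone K (ℓ₁ , ℓ₂) α β (e₁ , e₂) (f₁ , f₂) =
    solve 11 (λ p Q K ℓ₁ ℓ₂ α β e₁ e₂ f₁ f₂ →
      let ℓ = (ℓ₁ , ℓ₂) ; e = (e₁ , e₂) ; f = (f₁ , f₂) in
      excessᴾ p Q K ℓ (α •ᴾ e ⊕ᴾ β •ᴾ f) :=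
      α :* excessᴾ p Q K ℓ e :+ β :* excessᴾ p Q K ℓ f
        :+ K :* (α :* (α :- con (+ 1)) :* normᴾ p Q e :+ β :* (β :- con (+ 1)) :* normᴾ p Q f
                 :+ α :* β :* polarᴾ p Q e f))
      refl p (+ q) K ℓ₁ ℓ₂ α β e₁ e₂ f₁ f₂

  norm-τ* : ∀ x → normτ p q (mulτ p q τ-elt x) ≡ + q * normτ p q x
  norm-τ* (a , b) =
    solve 4 (λ p Q a b → normᴾ p Q (mulᴾ p Q τᴾ (a , b)) := Q :* normᴾ p Q (a , b)) refl p (+ q) a b

  norm-double : ∀ a b → + 2 * normτ p q (a , b) ≡
                        (a + p * b) * (a + p * b) + a * a + (+ q + (+ q - p * p)) * (b * b)
  norm-double a b =
    solve 4 (λ p Q a b → con (+ 2) :* normᴾ p Q (a , b) :=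
                         (a :+ p :* b) :* (a :+ p :* b) :+ a :* a :+ (Q :+ (Q :- p :* p)) :* (b :* b))
      refl p (+ q) a b

  -- τ̄ = p - τ is the adjoint of multiplication by τ.
  polar-τ* : ∀ z x → polarτ p q z (mulτ p q τ-elt x) ≡ polarτ p q (mulτ p q (p , -[1+ 0 ]) z) x
  polar-τ* (a , b) (c , d) =
    solve 6 (λ p Q a b c d → polarᴾ p Q (a , b) (mulᴾ p Q τᴾ (c , d)) :=
                             polarᴾ p Q (mulᴾ p Q (p , con -[1+ 0 ]) (a , b)) (c , d))
      refl p (+ q) a b c d

  τ̄*-first : ∀ z → proj₁ (mulτ p q (p , -[1+ 0 ]) z) ≡ p * proj₁ z + + q * proj₂ z
  τ̄*-first (a , b) =
    solve 4 (λ p Q a b → proj₁ (mulᴾ p Q (p , con -[1+ 0 ]) (a , b)) := p :* a :+ Q :* b) refl p (+ q) a b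

  polar-τ : ∀ z → polarτ p q z (powτ p q 1) ≡ p * proj₁ z + + q * (+ 2 * proj₂ z)
  polar-τ (a , b) =
    solve 4 (λ p Q a b → polarᴾ p Q (a , b) (mulᴾ p Q τᴾ oneᴾ) := p :* a :+ Q :* (con (+ 2) :* b))
      refl p (+ q) a b

  τ*-factor : ∀ b t → mulτ p q τ-elt (b + p * t , - t) ≡ (t * + q , b)
  τ*-factor b t = cong₂ _,_
    (solve 4 (λ p Q b t → proj₁ (mulᴾ p Q τᴾ (b :+ p :* t , :- t)) := t :* Q) refl p (+ q) b t)
    (solve 4 (λ p Q b t → proj₂ (mulᴾ p Q τᴾ (b :+ p :* t , :- t)) := b) refl p (+ q) b t)

  mulτ-distribˡ-⊖ : ∀ x y z → mulτ p q x (y ⊖ z) ≡ mulτ p q x y ⊖ mulτ p q x z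
  mulτ-distribˡ-⊖ (a , b) (c , d) (e , f) = cong₂ _,_
    (solve 8 (λ p Q a b c d e f → proj₁ (mulᴾ p Q (a , b) ((c , d) ⊖ᴾ (e , f))) :=
                                  proj₁ (mulᴾ p Q (a , b) (c , d) ⊖ᴾ mulᴾ p Q (a , b) (e , f)))
      refl p (+ q) a b c d e f)
    (solve 8 (λ p Q a b c d e f → proj₂ (mulᴾ p Q (a , b) ((c , d) ⊖ᴾ (e , f))) :=
                                  proj₂ (mulᴾ p Q (a , b) (c , d) ⊖ᴾ mulᴾ p Q (a , b) (e , f)))
      refl p (+ q) a b c d e f)

  mulτ-assoc : ∀ x y z → mulτ p q x (mulτ p q y z) ≡ mulτ p q (mulτ p q x y) z
  mulτ-assoc (a , b) (c , d) (e , f) = cong₂ _,_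
    (solve 8 (λ p Q a b c d e f → proj₁ (mulᴾ p Q (a , b) (mulᴾ p Q (c , d) (e , f))) :=
                                  proj₁ (mulᴾ p Q (mulᴾ p Q (a , b) (c , d)) (e , f)))
      refl p (+ q) a b c d e f)
    (solve 8 (λ p Q a b c d e f → proj₂ (mulᴾ p Q (a , b) (mulᴾ p Q (c , d) (e , f))) :=
                                  proj₂ (mulᴾ p Q (mulᴾ p Q (a , b) (c , d)) (e , f)))
      refl p (+ q) a b c d e f)

  mulτ-zeroʳ : ∀ x → mulτ p q x zero-τ ≡ zero-τ
  mulτ-zeroʳ (a , b) = cong₂ _,_
    (solve 4 (λ p Q a b → proj₁ (mulᴾ p Q (a , b) zeroᴾ) := con (+ 0)) refl p (+ q) a b)
    (solve 4 (λ p Q a b → proj₂ (mulᴾ p Q (a , b) zeroᴾ) := con (+ 0)) refl p (+ q) a b)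

  norm-c : ∀ c → normτ p q (c , + 0) ≡ c * c
  norm-c c = solve 3 (λ p Q c → normᴾ p Q (c , con (+ 0)) := c :* c) refl p (+ q) c

  norm-cτ : ∀ c → normτ p q (+ 0 , c) ≡ + q * (c * c)
  norm-cτ c = solve 3 (λ p Q c → normᴾ p Q (con (+ 0) , c) := Q :* (c :* c)) refl p (+ q) c

  norm-τ-p : normτ p q (- p , + 1) ≡ + q
  norm-τ-p = solve 2 (λ p Q → normᴾ p Q (:- p , con (+ 1)) := Q) refl p (+ q)

  norm-p-τ : normτ p q (p , -[1+ 0 ]) ≡ + q
  norm-p-τ = solve 2 (λ p Q → normᴾ p Q (p , con -[1+ 0 ]) := Q) refl p (+ q)

  polar-1-τ : ∀ c → polarτ p q (c , + 0) (+ 0 , c) ≡ p * (c * c)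
  polar-1-τ c = solve 3 (λ p Q c → polarᴾ p Q (c , con (+ 0)) (con (+ 0) , c) := p :* (c :* c)) refl p (+ q) c

  polar-τ-[τ-p] : ∀ c → polarτ p q (+ 0 , c) (- (p * c) , c) ≡ (+ q + (+ q - p * p)) * (c * c)
  polar-τ-[τ-p] c =
    solve 3 (λ p Q c → polarᴾ p Q (con (+ 0) , c) (:- (p :* c) , c) := (Q :+ (Q :- p :* p)) :* (c :* c))
      refl p (+ q) c

  polar-[τ-p]-[-p] : ∀ c → polarτ p q (- (p * c) , c) (- (p * c) , + 0) ≡ p * p * (c * c)
  polar-[τ-p]-[-p] c =
    solve 3 (λ p Q c → polarᴾ p Q (:- (p :* c) , c) (:- (p :* c) , con (+ 0)) := p :* p :* (c :* c))
      refl p (+ q) c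

  excess-at-1 : ∀ y T → excess p q (normτ p q T) (crossTerms p q y T) (+ 1 , + 0) ≡
                        normτ p q T - polarτ p q y T
  excess-at-1 (a , b) (c , d) =
    solve 6 (λ p Q a b c d → let y = (a , b) ; T = (c , d) in
      excessᴾ p Q (normᴾ p Q T) (crossᴾ p Q y T) oneᴾ :=
      normᴾ p Q T :- polarᴾ p Q y T)
      refl p (+ q) a b c d

  excess-at--1 : ∀ y T → excess p q (normτ p q T) (crossTerms p q y T) (-[1+ 0 ] , + 0) ≡
                         normτ p q T - - polarτ p q y T
  excess-at--1 (a , b) (c , d) =
    solve 6 (λ p Q a b c d → let y = (a , b) ; T = (c , d) in
      excessᴾ p Q (normᴾ p Q T) (crossᴾ p Q y T) (con -[1+ 0 ] , con (+ 0)) :=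
      normᴾ p Q T :- :- polarᴾ p Q y T)
      refl p (+ q) a b c d

  excess-at-τ : ∀ y T → excess p q (normτ p q T) (crossTerms p q y T) (+ 0 , + 1) ≡
                        + q * normτ p q T - polarτ p q y (mulτ p q τ-elt T)
  excess-at-τ (a , b) (c , d) =
    solve 6 (λ p Q a b c d → let y = (a , b) ; T = (c , d) in
      excessᴾ p Q (normᴾ p Q T) (crossᴾ p Q y T) τᴾ :=
      Q :* normᴾ p Q T :- polarᴾ p Q y (mulᴾ p Q τᴾ T))
      refl p (+ q) a b c d

  excess-at--τ : ∀ y T → excess p q (normτ p q T) (crossTerms p q y T) (+ 0 , -[1+ 0 ]) ≡
                         + q * normτ p q T - - polarτ p q y (mulτ p q τ-elt T)
  excess-at--τ (a , b) (c , d) =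
    solve 6 (λ p Q a b c d → let y = (a , b) ; T = (c , d) in
      excessᴾ p Q (normᴾ p Q T) (crossᴾ p Q y T) (con (+ 0) , con -[1+ 0 ]) :=
      Q :* normᴾ p Q T :- :- polarᴾ p Q y (mulᴾ p Q τᴾ T))
      refl p (+ q) a b c d

  -- (τ - p) τ = - q, so the cross terms of τ S against τ - p only see q ⟨y , S⟩.
  excess-at-τ-p : ∀ y S → let T = mulτ p q τ-elt S in
    excess p q (normτ p q T) (crossTerms p q y T) (- p , + 1) ≡ + q * normτ p q T - + q * - polarτ p q y S
  excess-at-τ-p (a , b) (c , d) =
    solve 6 (λ p Q a b c d → let y = (a , b) ; T = mulᴾ p Q τᴾ (c , d) in
      excessᴾ p Q (normᴾ p Q T) (crossᴾ p Q y T) (:- p , con (+ 1)) :=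
      Q :* normᴾ p Q T :- Q :* :- polarᴾ p Q y (c , d))
      refl p (+ q) a b c d

  excess-at-p-τ : ∀ y S → let T = mulτ p q τ-elt S in
    excess p q (normτ p q T) (crossTerms p q y T) (p , -[1+ 0 ]) ≡ + q * normτ p q T - + q * polarτ p q y S
  excess-at-p-τ (a , b) (c , d) =
    solve 6 (λ p Q a b c d → let y = (a , b) ; T = mulᴾ p Q τᴾ (c , d) in
      excessᴾ p Q (normᴾ p Q T) (crossᴾ p Q y T) (p , con -[1+ 0 ]) :=
      Q :* normᴾ p Q T :- Q :* polarᴾ p Q y (c , d))
      refl p (+ q) a b c d

  polar-reflect : ∀ x y → polarτ (- p) q (reflect x) (reflect y) ≡ polarτ p q x y
  polar-reflect (a , b) (c , d) =
    solve 6 (λ p Q a b c d → polarᴾ (:- p) Q (reflectᴾ (a , b)) (reflectᴾ (c , d)) :=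
                             polarᴾ p Q (a , b) (c , d))
      refl p (+ q) a b c d

0<1 : 0ℤ < + 1
0<1 = +<+ (s≤s z≤n)

0<q : ∀ q .{{_ : ℕ.NonZero q}} → 0ℤ < + q
0<q q = +<+ (ℕ.>-nonZero⁻¹ q)

0<2q-1 : ∀ q .{{_ : ℕ.NonZero q}} → 0ℤ < + q + (+ q - + 1)
0<2q-1 q = +-mono-<-≤ (0<q q) (i≤j⇒0≤j-i (+≤+ (ℕ.>-nonZero⁻¹ q)))

≡1⇒pos : ∀ {i} → i ≡ + 1 → 0ℤ < i
≡1⇒pos i≡1 = subst (0ℤ <_) (sym i≡1) 0<1

≡2q-1⇒pos : ∀ q .{{_ : ℕ.NonZero q}} {i} → i ≡ (+ q + (+ q - + 1)) * + 1 → 0ℤ < i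
≡2q-1⇒pos q i≡ = subst (0ℤ <_) (sym (trans i≡ (*-identityʳ _))) (0<2q-1 q)

*-nonNeg : ∀ {i j} → 0ℤ ≤ i → 0ℤ ≤ j → 0ℤ ≤ i * j
*-nonNeg (+≤+ {n = m} _) (+≤+ {n = n} _) = subst (0ℤ ≤_) (pos-* m n) (+≤+ z≤n)

square-nonNeg : ∀ i → 0ℤ ≤ i * i
square-nonNeg (+ n)    = *-nonNeg {+ n} {+ n} (+≤+ z≤n) (+≤+ z≤n)
square-nonNeg -[1+ n ] = +≤+ z≤n

0≤i*[i-1] : ∀ i → 0ℤ ≤ i * (i - + 1)
0≤i*[i-1] (+ zero)  = +≤+ z≤n
0≤i*[i-1] (+ suc n) = *-nonNeg {+ suc n} {+ n} (+≤+ z≤n) (+≤+ z≤n)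
0≤i*[i-1] -[1+ n ]  = +≤+ z≤n

i*[i-1]≡0⇒i≡0∨i≡1 : ∀ i → i * (i - + 1) ≡ 0ℤ → i ≡ 0ℤ ⊎ i ≡ + 1
i*[i-1]≡0⇒i≡0∨i≡1 i eq = Sum.map₂ (i-j≡0⇒i≡j i (+ 1)) (i*j≡0⇒i≡0∨j≡0 i eq)

*-pos⇒≡0 : ∀ i {j} → 0ℤ < j → i * j ≡ 0ℤ → i ≡ 0ℤ
*-pos⇒≡0 i 0<j eq with i*j≡0⇒i≡0∨j≡0 i eq
... | inj₁ i≡0 = i≡0
... | inj₂ refl = contradiction 0<j (<-irrefl refl)

pos-*⇒≡0 : ∀ {i} j → 0ℤ < i → i * j ≡ 0ℤ → j ≡ 0ℤ
pos-*⇒≡0 {i} j 0<i eq with i*j≡0⇒i≡0∨j≡0 i eq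
... | inj₁ refl = contradiction 0<i (<-irrefl refl)
... | inj₂ j≡0 = j≡0

nonNeg+nonNeg≡0 : ∀ {i j} → 0ℤ ≤ i → 0ℤ ≤ j → i + j ≡ 0ℤ → i ≡ 0ℤ × j ≡ 0ℤ
nonNeg+nonNeg≡0 (+≤+ {n = m} _) (+≤+ {n = n} _) eq =
  cong +_ (ℕₚ.m+n≡0⇒m≡0 m (+-injective eq)) , cong +_ (ℕₚ.m+n≡0⇒n≡0 m (+-injective eq))

[i+j]-i≡j : ∀ i j → i + j - i ≡ j
[i+j]-i≡j = solve-∀

i≤i+j⇒0≤j : ∀ i j → i ≤ i + j → 0ℤ ≤ j
i≤i+j⇒0≤j i j le = subst (0ℤ ≤_) ([i+j]-i≡j i j) (i≤j⇒0≤j-i le)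

0≤j⇒i≤i+j : ∀ i {j} → 0ℤ ≤ j → i ≤ i + j
0≤j⇒i≤i+j i {j} 0≤j = 0≤i-j⇒j≤i (subst (0ℤ ≤_) (sym ([i+j]-i≡j i j)) 0≤j)

i+j≡i⇒j≡0 : ∀ i j → i + j ≡ i → j ≡ 0ℤ
i+j≡i⇒j≡0 i j eq = trans (sym ([i+j]-i≡j i j)) (trans (cong (_- i) eq) (+-inverseʳ i))

j<0⇒i+j<i : ∀ i {j} → j < 0ℤ → i + j < i
j<0⇒i+j<i i {j} j<0 = subst (i + j <_) (+-identityʳ i) (+-monoʳ-< i j<0)

∣∣-mono-< : ∀ {i j} → 0ℤ ≤ i → i < j → ∣ i ∣ ℕ.< ∣ j ∣
∣∣-mono-< (+≤+ _) (+<+ m<n) = m<n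

∣-neg : ∀ {k} i → k ∣ - i → k ∣ i
∣-neg i d = subst (_ ∣_) (neg-involutive i) (∣m⇒∣-m d)

∣-unit : ∀ {k σ} i → IsUnit σ → k ∣ σ * i → k ∣ i
∣-unit i (inj₁ refl) d = subst (_ ∣_) (*-identityˡ i) d
∣-unit i (inj₂ refl) d = ∣-neg i (subst (_ ∣_) (-1*i≡-i i) d)

∣-by-≡ : ∀ {k} i j → i - j ≡ 0ℤ → k ∣ i → k ∣ j
∣-by-≡ i j eq = subst (_ ∣_) (i-j≡0⇒i≡j i j eq)

⊖-self : ∀ x → x ⊖ x ≡ zero-τ
⊖-self (a , b) = cong₂ _,_ (+-inverseʳ a) (+-inverseʳ b)

⊖-identityʳ : ∀ x → x ⊖ zero-τ ≡ x
⊖-identityʳ (a , b) = cong₂ _,_ (+-identityʳ a) (+-identityʳ b)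

⊖-swap : ∀ x y z → (x ⊖ y) ⊖ z ≡ (x ⊖ z) ⊖ y
⊖-swap (a , b) (c , d) (e , f) = cong₂ _,_ (swap a c e) (swap b d f)
  where
  swap : ∀ i j k → i - j - k ≡ i - k - j
  swap = solve-∀

⊖-⊖-cancel : ∀ x y z → x ⊖ ((x ⊖ y) ⊖ (z ⊖ y)) ≡ z
⊖-⊖-cancel (a , b) (c , d) (e , f) = cong₂ _,_ (cancel a c e) (cancel b d f)
  where
  cancel : ∀ i j k → i - ((i - j) - (k - j)) ≡ k
  cancel = solve-∀

module Congruence (p : ℤ) (q w : ℕ) where

  Congτ-refl : ∀ x → Congτ p q w x x
  Congτ-refl x = zero-τ , trans (mulτ-zeroʳ p q (powτ p q w)) (sym (⊖-self x))

  Congτ-shift : ∀ y x → Congτ p q w y x → ∀ a → Congτ p q w (y ⊖ mulτ p q (powτ p q w) a) x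
  Congτ-shift y x (c , Tc≡y⊖x) a = c ⊖ a , (begin
    mulτ p q T (c ⊖ a)              ≡⟨ mulτ-distribˡ-⊖ p q T c a ⟩
    mulτ p q T c ⊖ mulτ p q T a     ≡⟨ cong (_⊖ mulτ p q T a) Tc≡y⊖x ⟩
    (y ⊖ x) ⊖ mulτ p q T a          ≡⟨ ⊖-swap y x (mulτ p q T a) ⟩
    (y ⊖ mulτ p q T a) ⊖ x          ∎)
    where
    open ≡-Reasoning
    T : Zτ
    T = powτ p q w

  Congτ⇒shifted : ∀ z y x → Congτ p q w z x → Congτ p q w y x →
                  Σ Zτ λ v → z ≡ y ⊖ mulτ p q (powτ p q w) v
  Congτ⇒shifted z y x (c , Tc≡z⊖x) (d , Td≡y⊖x) = d ⊖ c , (begin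
    z                                   ≡⟨ ⊖-⊖-cancel y x z ⟨
    y ⊖ ((y ⊖ x) ⊖ (z ⊖ x))             ≡⟨ cong (y ⊖_) (cong₂ _⊖_ Td≡y⊖x Tc≡z⊖x) ⟨
    y ⊖ (mulτ p q T d ⊖ mulτ p q T c)   ≡⟨ cong (y ⊖_) (mulτ-distribˡ-⊖ p q T d c) ⟨
    y ⊖ mulτ p q T (d ⊖ c)              ∎)
    where
    open ≡-Reasoning
    T : Zτ
    T = powτ p q w

τ∣-resp-Congτ : ∀ p q w y x → Congτ p q (suc w) y x → Dividesτ p q τ-elt y → Dividesτ p q τ-elt x
τ∣-resp-Congτ p q w _ x y≡x (e , refl) = factor (Congτ⇒shifted x (mulτ p q τ-elt e) x (Congτ-refl x) y≡x)
  where
  open Congruence p q (suc w)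
  S : Zτ
  S = powτ p q w
  factor : Σ Zτ (λ v → x ≡ mulτ p q τ-elt e ⊖ mulτ p q (mulτ p q τ-elt S) v) → Dividesτ p q τ-elt x
  factor (v , x≡) = e ⊖ mulτ p q S v , (begin
    mulτ p q τ-elt (e ⊖ mulτ p q S v)                 ≡⟨ mulτ-distribˡ-⊖ p q τ-elt e (mulτ p q S v) ⟩
    mulτ p q τ-elt e ⊖ mulτ p q τ-elt (mulτ p q S v)  ≡⟨ cong (mulτ p q τ-elt e ⊖_) (mulτ-assoc p q τ-elt S v) ⟩
    mulτ p q τ-elt e ⊖ mulτ p q (mulτ p q τ-elt S) v  ≡⟨ x≡ ⟨
    x                                                 ∎)
    where open ≡-Reasoning

q∣first⇒τ∣ : ∀ p q z → + q ∣ proj₁ z → Dividesτ p q τ-elt z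
q∣first⇒τ∣ p q (a , b) (divides t refl) = (b + p * t , - t) , τ*-factor p q b t

module _ {p : ℤ} {q : ℕ} (p-unit : IsUnit p) where

  private
    q∣p*a : ∀ a b → + q ∣ p * a + + q * b → + q ∣ a
    q∣p*a a b d = ∣-unit a p-unit (∣m+n∣n⇒∣m {n = + q * b} d (∣m⇒∣m*n b ∣-refl))

  -- ⟨z , τ ^ (k + 1)⟩ ≡ ⟨τ̄ ^ k z , τ⟩ ≡ p (τ̄ ^ k z)₁ and (τ̄ z)₁ ≡ p z₁ modulo q.
  q∣polar-τ^⇒q∣first : ∀ k z → + q ∣ polarτ p q z (powτ p q (suc k)) → + q ∣ proj₁ z
  q∣polar-τ^⇒q∣first zero    z d = q∣p*a (proj₁ z) (+ 2 * proj₂ z) (subst (+ q ∣_) (polar-τ p q z) d)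
  q∣polar-τ^⇒q∣first (suc k) z d =
    q∣p*a (proj₁ z) (proj₂ z) (subst (+ q ∣_) (τ̄*-first p q z)
      (q∣polar-τ^⇒q∣first k (mulτ p q (p , -[1+ 0 ]) z)
        (subst (+ q ∣_) (polar-τ* p q z (powτ p q (suc k))) d)))

  q∣polar-τ^⇒τ∣ : ∀ k z → + q ∣ polarτ p q z (powτ p q (suc k)) → Dividesτ p q τ-elt z
  q∣polar-τ^⇒τ∣ k z = q∣first⇒τ∣ p q z ∘ q∣polar-τ^⇒q∣first k z

-- The cone decomposition

norm-nonNeg : ∀ {p} q .{{_ : ℕ.NonZero q}} → IsUnit p → ∀ x → 0ℤ ≤ normτ p q x
norm-nonNeg {p} q p-unit (a , b) = *-cancelˡ-≤-pos 0ℤ (normτ p q (a , b)) (+ 2)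
  (subst (0ℤ ≤_) (sym (norm-double p q a b))
    (+-mono-≤ (+-mono-≤ (square-nonNeg (a + p * b)) (square-nonNeg a))
              (*-nonNeg (coefficient p-unit) (square-nonNeg b))))
  where
  coefficient : IsUnit p → 0ℤ ≤ + q + (+ q - p * p)
  coefficient (inj₁ refl) = <⇒≤ (0<2q-1 q)
  coefficient (inj₂ refl) = <⇒≤ (0<2q-1 q)

norm-τ^ : ∀ p q k → normτ p q (powτ p q k) ≡ + (q ℕ.^ k)
norm-τ^ p q zero    = norm-c p q (+ 1)
norm-τ^ p q (suc k) =
  trans (norm-τ* p q (powτ p q k)) (trans (cong (+ q *_) (norm-τ^ p q k)) (sym (pos-* q (q ℕ.^ k))))

norm-τ^-pos : ∀ p q .{{_ : ℕ.NonZero q}} k → 0ℤ < normτ p q (powτ p q k)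
norm-τ^-pos p q k = subst (0ℤ <_) (sym (norm-τ^ p q k)) (+<+ (ℕ.>-nonZero⁻¹ (q ℕ.^ k) {{ℕₚ.m^n≢0 q k}}))

q∣norm-τ* : ∀ p q x → + q ∣ normτ p q (mulτ p q τ-elt x)
q∣norm-τ* p q x = subst (+ q ∣_) (sym (norm-τ* p q x)) (∣m⇒∣m*n (normτ p q x) ∣-refl)

neighbour-norm-pos : ∀ p q .{{_ : ℕ.NonZero q}} {e} → e ∈ neighbours p → 0ℤ < normτ p q e
neighbour-norm-pos p q (here refl)                     = ≡1⇒pos (norm-c p q (+ 1))
neighbour-norm-pos p q (there (here refl))             = ≡1⇒pos (norm-c p q -[1+ 0 ])
neighbour-norm-pos p q (there (there (here refl)))     =
  subst (0ℤ <_) (sym (trans (norm-cτ p q (+ 1)) (*-identityʳ (+ q)))) (0<q q)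
neighbour-norm-pos p q (there (there (there (here refl)))) =
  subst (0ℤ <_) (sym (trans (norm-cτ p q -[1+ 0 ]) (*-identityʳ (+ q)))) (0<q q)
neighbour-norm-pos p q (there (there (there (there (here refl))))) =
  subst (0ℤ <_) (sym (norm-τ-p p q)) (0<q q)
neighbour-norm-pos p q (there (there (there (there (there (here refl)))))) =
  subst (0ℤ <_) (sym (norm-p-τ p q)) (0<q q)

record Cone (p : ℤ) (q : ℕ) (u : Zτ) : Set where
  constructor mkCone
  field
    e f       : Zτ
    e∈        : e ∈ neighbours p
    f∈        : f ∈ neighbours p
    polar-pos : 0ℤ < polarτ p q e f
    α β       : ℤ
    α-nonNeg  : 0ℤ ≤ α
    β-nonNeg  : 0ℤ ≤ β
    spans     : u ≡ α • e ⊕ β • f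

cone-at : ∀ {p q m n} e f → e ∈ neighbours p → f ∈ neighbours p → 0ℤ < polarτ p q e f →
          ∀ α β → 0ℤ ≤ α → 0ℤ ≤ β →
          m ≡ α * proj₁ e + β * proj₁ f → n ≡ α * proj₂ e + β * proj₂ f → Cone p q (m , n)
cone-at e f e∈ f∈ pos α β 0≤α 0≤β refl refl = mkCone e f e∈ f∈ pos α β 0≤α 0≤β refl

cone₊ : ∀ q .{{_ : ℕ.NonZero q}} u → Cone (+ 1) q u
cone₊ q (m , n) with ≤-total 0ℤ m | ≤-total 0ℤ n | ≤-total 0ℤ (m + n)
... | inj₁ 0≤m | inj₁ 0≤n | _ =
  cone-at (+ 1 , + 0) (+ 0 , + 1) (here refl) (there (there (here refl)))
    (≡1⇒pos (polar-1-τ (+ 1) q (+ 1))) m n 0≤m 0≤n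
    (solve 2 (λ m n → m := m :* con (+ 1) :+ n :* con (+ 0)) refl m n)
    (solve 2 (λ m n → n := m :* con (+ 0) :+ n :* con (+ 1)) refl m n)
... | inj₂ m≤0 | inj₂ n≤0 | _ =
  cone-at (-[1+ 0 ] , + 0) (+ 0 , -[1+ 0 ]) (there (here refl)) (there (there (there (here refl))))
    (≡1⇒pos (polar-1-τ (+ 1) q -[1+ 0 ])) (- m) (- n) (neg-mono-≤ m≤0) (neg-mono-≤ n≤0)
    (solve 2 (λ m n → m := :- m :* con -[1+ 0 ] :+ :- n :* con (+ 0)) refl m n)
    (solve 2 (λ m n → n := :- m :* con (+ 0) :+ :- n :* con -[1+ 0 ]) refl m n)
... | inj₂ m≤0 | inj₁ 0≤n | inj₁ 0≤m+n =
  cone-at (+ 0 , + 1) (-[1+ 0 ] , + 1) (there (there (here refl))) (there (there (there (there (here refl)))))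
    (≡2q-1⇒pos q (polar-τ-[τ-p] (+ 1) q (+ 1))) (m + n) (- m) 0≤m+n (neg-mono-≤ m≤0)
    (solve 2 (λ m n → m := (m :+ n) :* con (+ 0) :+ :- m :* con -[1+ 0 ]) refl m n)
    (solve 2 (λ m n → n := (m :+ n) :* con (+ 1) :+ :- m :* con (+ 1)) refl m n)
... | inj₂ m≤0 | inj₁ 0≤n | inj₂ m+n≤0 =
  cone-at (-[1+ 0 ] , + 1) (-[1+ 0 ] , + 0) (there (there (there (there (here refl))))) (there (here refl))
    (≡1⇒pos (polar-[τ-p]-[-p] (+ 1) q (+ 1))) n (- (m + n)) 0≤n (neg-mono-≤ m+n≤0)
    (solve 2 (λ m n → m := n :* con -[1+ 0 ] :+ :- (m :+ n) :* con -[1+ 0 ]) refl m n)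
    (solve 2 (λ m n → n := n :* con (+ 1) :+ :- (m :+ n) :* con (+ 0)) refl m n)
... | inj₁ 0≤m | inj₂ n≤0 | inj₂ m+n≤0 =
  cone-at (+ 0 , -[1+ 0 ]) (+ 1 , -[1+ 0 ]) (there (there (there (here refl))))
    (there (there (there (there (there (here refl))))))
    (≡2q-1⇒pos q (polar-τ-[τ-p] (+ 1) q -[1+ 0 ])) (- (m + n)) m (neg-mono-≤ m+n≤0) 0≤m
    (solve 2 (λ m n → m := :- (m :+ n) :* con (+ 0) :+ m :* con (+ 1)) refl m n)
    (solve 2 (λ m n → n := :- (m :+ n) :* con -[1+ 0 ] :+ m :* con -[1+ 0 ]) refl m n)
... | inj₁ 0≤m | inj₂ n≤0 | inj₁ 0≤m+n =
  cone-at (+ 1 , -[1+ 0 ]) (+ 1 , + 0) (there (there (there (there (there (here refl)))))) (here refl)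
    (≡1⇒pos (polar-[τ-p]-[-p] (+ 1) q -[1+ 0 ])) (- n) (m + n) (neg-mono-≤ n≤0) 0≤m+n
    (solve 2 (λ m n → m := :- n :* con (+ 1) :+ (m :+ n) :* con (+ 1)) refl m n)
    (solve 2 (λ m n → n := :- n :* con -[1+ 0 ] :+ (m :+ n) :* con (+ 0)) refl m n)

reflect-involutive : ∀ x → reflect (reflect x) ≡ x
reflect-involutive (a , b) = cong (a ,_) (neg-involutive b)

reflect-•-⊕ : ∀ α β e f → reflect (α • e ⊕ β • f) ≡ α • reflect e ⊕ β • reflect f
reflect-•-⊕ α β (a , b) (c , d) = cong (α * a + β * c ,_) (neg-distrib α β b d)
  where
  neg-distrib : ∀ α β b d → - (α * b + β * d) ≡ α * - b + β * - d
  neg-distrib = solve-∀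

reflect-neighbour : ∀ {e} → e ∈ neighbours (+ 1) → reflect e ∈ neighbours -[1+ 0 ]
reflect-neighbour (here refl)                                          = here refl
reflect-neighbour (there (here refl))                                  = there (here refl)
reflect-neighbour (there (there (here refl)))                          = there (there (there (here refl)))
reflect-neighbour (there (there (there (here refl))))                  = there (there (here refl))
reflect-neighbour (there (there (there (there (here refl)))))          = there (there (there (there (there (here refl)))))
reflect-neighbour (there (there (there (there (there (here refl)))))) = there (there (there (there (here refl))))

reflect-cone : ∀ {q u} → Cone (+ 1) q (reflect u) → Cone -[1+ 0 ] q u
reflect-cone {q} {u} (mkCone e f e∈ f∈ pos α β 0≤α 0≤β spans) =
  mkCone (reflect e) (reflect f) (reflect-neighbour e∈) (reflect-neighbour f∈)
    (subst (0ℤ <_) (sym (polar-reflect (+ 1) q e f)) pos) α β 0≤α 0≤β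
    (trans (sym (reflect-involutive u)) (trans (cong reflect spans) (reflect-•-⊕ α β e f)))

cone : ∀ {p} q .{{_ : ℕ.NonZero q}} → IsUnit p → ∀ u → Cone p q u
cone q (inj₁ refl) u = cone₊ q u
cone q (inj₂ refl) u = reflect-cone (cone₊ q (reflect u))

•-⊕-unitˡ : ∀ e f → (+ 1) • e ⊕ (+ 0) • f ≡ e
•-⊕-unitˡ (a , b) (c , d) =
  cong₂ _,_ (trans (+-identityʳ (+ 1 * a)) (*-identityˡ a)) (trans (+-identityʳ (+ 1 * b)) (*-identityˡ b))

•-⊕-unitʳ : ∀ e f → (+ 0) • e ⊕ (+ 1) • f ≡ f
•-⊕-unitʳ (a , b) (c , d) =
  cong₂ _,_ (trans (+-identityˡ (+ 1 * c)) (*-identityˡ c)) (trans (+-identityˡ (+ 1 * d)) (*-identityˡ d))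

module _ {p : ℤ} {q : ℕ} .{{_ : ℕ.NonZero q}} (p-unit : IsUnit p) (K : ℤ) (ℓ : Zτ) where

  private
    norm-term-nonNeg : ∀ {e} → e ∈ neighbours p → ∀ α → 0ℤ ≤ α * (α - + 1) * normτ p q e
    norm-term-nonNeg e∈ α = *-nonNeg (0≤i*[i-1] α) (<⇒≤ (neighbour-norm-pos p q e∈))

    polar-term-nonNeg : ∀ e f α β → 0ℤ < polarτ p q e f → 0ℤ ≤ α → 0ℤ ≤ β →
                        0ℤ ≤ α * β * polarτ p q e f
    polar-term-nonNeg e f α β 0<ef 0≤α 0≤β = *-nonNeg (*-nonNeg 0≤α 0≤β) (<⇒≤ 0<ef)

  excess-nonNeg : 0ℤ ≤ K → All (λ e → 0ℤ ≤ excess p q K ℓ e) (neighbours p) →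
                  ∀ u → 0ℤ ≤ excess p q K ℓ u
  excess-nonNeg 0≤K local u with cone q p-unit u
  ... | mkCone e f e∈ f∈ 0<ef α β 0≤α 0≤β refl =
    subst (0ℤ ≤_) (sym (excess-cone p q K ℓ α β e f))
      (+-mono-≤ (+-mono-≤ (*-nonNeg 0≤α (lookup local e∈)) (*-nonNeg 0≤β (lookup local f∈)))
                (*-nonNeg 0≤K (+-mono-≤ (+-mono-≤ (norm-term-nonNeg e∈ α) (norm-term-nonNeg f∈ β))
                                        (polar-term-nonNeg e f α β 0<ef 0≤α 0≤β))))

  -- At a zero every term of excess-cone vanishes: α , β ∈ {0 , 1} and α β ≡ 0.
  excess≡0 : 0ℤ < K → (∀ u → 0ℤ ≤ excess p q K ℓ u) → ∀ u → excess p q K ℓ u ≡ 0ℤ →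
             u ≡ zero-τ ⊎ u ∈ neighbours p
  excess≡0 0<K global u Eu≡0 with cone q p-unit u
  ... | mkCone e f e∈ f∈ 0<ef α β 0≤α 0≤β refl =
    corner e∈ f∈ (i*[i-1]≡0⇒i≡0∨i≡1 α (*-pos⇒≡0 _ (neighbour-norm-pos p q e∈) (proj₁ A≡0×B≡0)))
                 (i*[i-1]≡0⇒i≡0∨i≡1 β (*-pos⇒≡0 _ (neighbour-norm-pos p q f∈) (proj₂ A≡0×B≡0)))
                 (*-pos⇒≡0 (α * β) 0<ef (proj₂ A+B≡0×C≡0))
    where
    0≤A : 0ℤ ≤ α * (α - + 1) * normτ p q e
    0≤A = norm-term-nonNeg e∈ α

    0≤B : 0ℤ ≤ β * (β - + 1) * normτ p q f
    0≤B = norm-term-nonNeg f∈ β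

    0≤C : 0ℤ ≤ α * β * polarτ p q e f
    0≤C = polar-term-nonNeg e f α β 0<ef 0≤α 0≤β

    A+B+C≡0 : α * (α - + 1) * normτ p q e + β * (β - + 1) * normτ p q f + α * β * polarτ p q e f ≡ 0ℤ
    A+B+C≡0 = pos-*⇒≡0 _ 0<K (proj₂ (nonNeg+nonNeg≡0
      (+-mono-≤ (*-nonNeg 0≤α (global e)) (*-nonNeg 0≤β (global f)))
      (*-nonNeg (<⇒≤ 0<K) (+-mono-≤ (+-mono-≤ 0≤A 0≤B) 0≤C))
      (trans (sym (excess-cone p q K ℓ α β e f)) Eu≡0)))

    A+B≡0×C≡0 : α * (α - + 1) * normτ p q e + β * (β - + 1) * normτ p q f ≡ 0ℤ × α * β * polarτ p q e f ≡ 0ℤ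
    A+B≡0×C≡0 = nonNeg+nonNeg≡0 (+-mono-≤ 0≤A 0≤B) 0≤C A+B+C≡0

    A≡0×B≡0 : α * (α - + 1) * normτ p q e ≡ 0ℤ × β * (β - + 1) * normτ p q f ≡ 0ℤ
    A≡0×B≡0 = nonNeg+nonNeg≡0 0≤A 0≤B (proj₁ A+B≡0×C≡0)

    corner : ∀ {e f α β} → e ∈ neighbours p → f ∈ neighbours p →
             α ≡ 0ℤ ⊎ α ≡ + 1 → β ≡ 0ℤ ⊎ β ≡ + 1 → α * β ≡ 0ℤ →
             α • e ⊕ β • f ≡ zero-τ ⊎ α • e ⊕ β • f ∈ neighbours p
    corner e∈ f∈ (inj₁ refl) (inj₁ refl) _ = inj₁ refl
    corner {e} {f} e∈ f∈ (inj₂ refl) (inj₁ refl) _ =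
      inj₂ (subst (_∈ neighbours p) (sym (•-⊕-unitˡ e f)) e∈)
    corner {e} {f} e∈ f∈ (inj₁ refl) (inj₂ refl) _ =
      inj₂ (subst (_∈ neighbours p) (sym (•-⊕-unitʳ e f)) f∈)
    corner e∈ f∈ (inj₂ refl) (inj₂ refl) ()

-- Closest representatives

module Representatives {p : ℤ} {q : ℕ} .{{_ : ℕ.NonZero q}} (p-unit : IsUnit p) (w : ℕ) where

  open Congruence p q w

  voronoi⇒gain-nonNeg : ∀ y → InScaledVoronoi p q w y → ∀ u → 0ℤ ≤ gain p q w y u
  voronoi⇒gain-nonNeg y vor u =
    i≤i+j⇒0≤j _ _ (subst (normτ p q y ≤_) (norm-⊖-mul p q y (powτ p q w) u) (vor u))

  gain-nonNeg⇒voronoi : ∀ y → (∀ u → 0ℤ ≤ gain p q w y u) → InScaledVoronoi p q w y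
  gain-nonNeg⇒voronoi y 0≤gain u =
    subst (normτ p q y ≤_) (sym (norm-⊖-mul p q y (powτ p q w) u)) (0≤j⇒i≤i+j (normτ p q y) (0≤gain u))

  private
    _⊏_ : Zτ → Zτ → Set
    y ⊏ z = ∣ normτ p q y ∣ ℕ.< ∣ normτ p q z ∣

  descend : ∀ x y → Acc _⊏_ y → Congτ p q w y x → Σ Zτ λ z → Congτ p q w z x × InScaledVoronoi p q w z
  descend x y (acc smaller) y≡x with any? (λ e → gain p q w y e <? 0ℤ) (neighbours p)
  ... | yes lowering = step (satisfied lowering)
    where
    step : Σ Zτ (λ e → gain p q w y e < 0ℤ) → Σ Zτ λ z → Congτ p q w z x × InScaledVoronoi p q w z
    step (e , gain<0) = descend x (y ⊖ mulτ p q (powτ p q w) e)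
      (smaller (∣∣-mono-< (norm-nonNeg q p-unit (y ⊖ mulτ p q (powτ p q w) e))
        (subst (_< normτ p q y) (sym (norm-⊖-mul p q y (powτ p q w) e)) (j<0⇒i+j<i (normτ p q y) gain<0))))
      (Congτ-shift y x y≡x e)
  ... | no ¬lowering = y , y≡x , gain-nonNeg⇒voronoi y
    (excess-nonNeg {p} {q} p-unit (normτ p q (powτ p q w)) (crossTerms p q y (powτ p q w))
      (norm-nonNeg q p-unit (powτ p q w)) (All.map ≮⇒≥ (¬Any⇒All¬ (neighbours p) ¬lowering)))

  closest-representative : ∀ x → Σ Zτ λ y → Congτ p q w y x × InScaledVoronoi p q w y
  closest-representative x =
    descend x x (On.wellFounded (λ y → ∣ normτ p q y ∣) ℕᵢ.<-wellFounded x) (Congτ-refl x)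

  closest-minimal : ∀ x y z → InScaledVoronoi p q w y → Congτ p q w y x → Congτ p q w z x →
                    normτ p q y ≤ normτ p q z
  closest-minimal x y z vor y≡x z≡x =
    let (v , z≡y⊖Tv) = Congτ⇒shifted z y x z≡x y≡x in
    subst (λ t → normτ p q y ≤ normτ p q t) (sym z≡y⊖Tv) (vor v)

-- Uniqueness

-- At a neighbour e, a zero of the excess means ⟨ℓ , e⟩ = |τ τ S|² |e|², a multiple of q;
-- for e = ±(τ - p) both sides carry a further factor q (excess-at-τ-p).
module _ (p : ℤ) (q : ℕ) .{{_ : ℕ.NonZero q}} (y S : Zτ) where

  private
    τS : Zτ
    τS = mulτ p q τ-elt S

    q∣-cancel : ∀ X → + q * normτ p q τS - + q * X ≡ 0ℤ → + q ∣ X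
    q∣-cancel X eq =
      subst (+ q ∣_) (*-cancelˡ-≡ (+ q) (normτ p q τS) X (i-j≡0⇒i≡j _ _ eq)) (q∣norm-τ* p q S)

  neighbour-tie : ∀ {v} → v ∈ neighbours p →
    excess p q (normτ p q (mulτ p q τ-elt S)) (crossTerms p q y (mulτ p q τ-elt S)) v ≡ 0ℤ →
    (+ q ∣ polarτ p q y S)
      ⊎ (+ q ∣ polarτ p q y (mulτ p q τ-elt S))
      ⊎ (+ q ∣ polarτ p q y (mulτ p q τ-elt (mulτ p q τ-elt S)))
  neighbour-tie (here refl) E≡0 = inj₂ (inj₁
    (∣-by-≡ (normτ p q τS) _ (trans (sym (excess-at-1 p q y τS)) E≡0) (q∣norm-τ* p q S)))
  neighbour-tie (there (here refl)) E≡0 = inj₂ (inj₁ (∣-neg _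
    (∣-by-≡ (normτ p q τS) _ (trans (sym (excess-at--1 p q y τS)) E≡0) (q∣norm-τ* p q S))))
  neighbour-tie (there (there (here refl))) E≡0 = inj₂ (inj₂
    (∣-by-≡ (+ q * normτ p q τS) _ (trans (sym (excess-at-τ p q y τS)) E≡0) (∣m⇒∣m*n (normτ p q τS) ∣-refl)))
  neighbour-tie (there (there (there (here refl)))) E≡0 = inj₂ (inj₂ (∣-neg _
    (∣-by-≡ (+ q * normτ p q τS) _ (trans (sym (excess-at--τ p q y τS)) E≡0) (∣m⇒∣m*n (normτ p q τS) ∣-refl))))
  neighbour-tie (there (there (there (there (here refl))))) E≡0 =
    inj₁ (∣-neg _ (q∣-cancel _ (trans (sym (excess-at-τ-p p q y S)) E≡0)))
  neighbour-tie (there (there (there (there (there (here refl)))))) E≡0 =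
    inj₁ (q∣-cancel _ (trans (sym (excess-at-p-τ p q y S)) E≡0))

-- w is kept a variable, so that τ ^ w stays a neutral term for the conversion
-- checker; its shape is only used through w≡2+w'.
module Classes {p : ℤ} {q : ℕ} .{{_ : ℕ.NonZero q}} (p-unit : IsUnit p)
               {w w' : ℕ} (w≡2+w' : w ≡ suc (suc w')) where

  open Congruence p q w
  open Representatives {p} {q} p-unit w

  tie⇒gain≡0 : ∀ y v → normτ p q (y ⊖ mulτ p q (powτ p q w) v) ≡ normτ p q y → gain p q w y v ≡ 0ℤ
  tie⇒gain≡0 y v tie = i+j≡i⇒j≡0 _ _ (trans (sym (norm-⊖-mul p q y (powτ p q w) v)) tie)

  τ∣-of-tie : ∀ y {v} → v ∈ neighbours p → gain p q w y v ≡ 0ℤ → Dividesτ p q τ-elt y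
  τ∣-of-tie y {v} v∈ gain≡0
    with neighbour-tie p q y (powτ p q (suc w')) v∈
           (subst (λ T → excess p q (normτ p q T) (crossTerms p q y T) v ≡ 0ℤ) (cong (powτ p q) w≡2+w') gain≡0)
  ... | inj₁ q∣⟨y,S⟩         = q∣polar-τ^⇒τ∣ p-unit w' y q∣⟨y,S⟩
  ... | inj₂ (inj₁ q∣⟨y,τS⟩)  = q∣polar-τ^⇒τ∣ p-unit (suc w') y q∣⟨y,τS⟩
  ... | inj₂ (inj₂ q∣⟨y,ττS⟩) = q∣polar-τ^⇒τ∣ p-unit (suc (suc w')) y q∣⟨y,ττS⟩

  no-ties : ∀ y → ¬ Dividesτ p q τ-elt y → InScaledVoronoi p q w y →
            ∀ v → normτ p q (y ⊖ mulτ p q (powτ p q w) v) ≡ normτ p q y → v ≡ zero-τ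
  no-ties y τ∤y vor v tie =
    [ id , ⊥-elim ∘ τ∤y ∘ (λ v∈ → τ∣-of-tie y v∈ (tie⇒gain≡0 y v tie)) ]′
      (excess≡0 {p} {q} p-unit (normτ p q (powτ p q w)) (crossTerms p q y (powτ p q w))
        (norm-τ^-pos p q w) (voronoi⇒gain-nonNeg y vor) v (tie⇒gain≡0 y v tie))

  closest-unique : ∀ x y z → ¬ Dividesτ p q τ-elt y → InScaledVoronoi p q w y →
                   Congτ p q w y x → Congτ p q w z x → normτ p q z ≤ normτ p q y → z ≡ y
  closest-unique x y z τ∤y vor y≡x z≡x z≤y = begin
    z                                 ≡⟨ z≡y⊖Tv ⟩
    y ⊖ mulτ p q (powτ p q w) v       ≡⟨ cong (λ u → y ⊖ mulτ p q (powτ p q w) u) (no-ties y τ∤y vor v tie) ⟩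
    y ⊖ mulτ p q (powτ p q w) zero-τ  ≡⟨ cong (y ⊖_) (mulτ-zeroʳ p q (powτ p q w)) ⟩
    y ⊖ zero-τ                        ≡⟨ ⊖-identityʳ y ⟩
    y                                 ∎
    where
    open ≡-Reasoning
    v : Zτ
    v = proj₁ (Congτ⇒shifted z y x z≡x y≡x)
    z≡y⊖Tv : z ≡ y ⊖ mulτ p q (powτ p q w) v
    z≡y⊖Tv = proj₂ (Congτ⇒shifted z y x z≡x y≡x)
    tie : normτ p q (y ⊖ mulτ p q (powτ p q w) v) ≡ normτ p q y
    tie = ≤-antisym (subst (λ t → normτ p q t ≤ normτ p q y) z≡y⊖Tv z≤y) (vor v)

  closest-in-class : ∀ x → ¬ Dividesτ p q τ-elt x →
    Σ Zτ (λ y → Congτ p q w y x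
      × ((z : Zτ) → Congτ p q w z x → normτ p q y ≤ normτ p q z)
      × ((z : Zτ) → Congτ p q w z x → ((u : Zτ) → Congτ p q w u x → normτ p q z ≤ normτ p q u) → z ≡ y))
  closest-in-class x τ∤x with closest-representative x
  ... | y , y≡x , vor =
    y , y≡x , (λ z z≡x → closest-minimal x y z vor y≡x z≡x)
            , (λ z z≡x z-min → closest-unique x y z τ∤y vor y≡x z≡x (z-min y y≡x))
    where
    τ∤y : ¬ Dividesτ p q τ-elt y
    τ∤y = τ∤x ∘ τ∣-resp-Congτ p q (suc w') y x (subst (λ k → Congτ p q k y x) w≡2+w' y≡x)

  digit-sets-agree : ∀ D D' → IsMinNormDigitSet p q w D → IsMinNormDigitSet p q w D' → ∀ x → D x → D' x
  digit-sets-agree D D' (_ , D-shape , _ , D-voronoi) (D'0 , D'-shape , D'-represents , D'-voronoi) x Dx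
    with D-shape x Dx
  ... | inj₁ refl = D'0
  ... | inj₂ τ∤x with D'-represents x τ∤x
  ...   | d , D'd , d≡x , _ with D'-shape d D'd
  ...     | inj₁ refl = ⊥-elim (τ∤x (τ∣-resp-Congτ p q (suc w') zero-τ x
                            (subst (λ k → Congτ p q k zero-τ x) w≡2+w' d≡x) (zero-τ , mulτ-zeroʳ p q τ-elt)))
  ...     | inj₂ τ∤d = subst D' d≡x' D'd
    where
    d≡x' : d ≡ x
    d≡x' = closest-unique x x d τ∤x (D-voronoi x Dx τ∤x) (Congτ-refl x) d≡x
             (closest-minimal x d x (D'-voronoi d D'd τ∤d) d≡x (Congτ-refl x))

proposition12p2 : (q : ℕ) → 2 Data.Nat.≤ q → (p : ℤ) → (p ≡ + 1 ⊎ p ≡ -[1+ 0 ]) →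
    (w : ℕ) → 2 Data.Nat.≤ w →
    ((x : Zτ) → ¬ Dividesτ p q τ-elt x →
      Σ Zτ (λ y → Congτ p q w y x
        × ((z : Zτ) → Congτ p q w z x → normτ p q y ≤ normτ p q z)
        × ((z : Zτ) → Congτ p q w z x →
             ((u : Zτ) → Congτ p q w u x → normτ p q z ≤ normτ p q u) → z ≡ y)))
    × ((D D' : Zτ → Set) → IsMinNormDigitSet p q w D → IsMinNormDigitSet p q w D' →
        (x : Zτ) → (D x → D' x) × (D' x → D x))
proposition12p2 q@(suc (suc _)) (s≤s (s≤s z≤n)) p p-unit (suc (suc w')) (s≤s (s≤s z≤n)) =
  closest-in-class , λ D D' D-digits D'-digits x →
    digit-sets-agree D D' D-digits D'-digits x , digit-sets-agree D' D D'-digits D-digits x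
  where open Classes {p} {q} p-unit {suc (suc w')} {w'} refl
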